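{- The merge operator $\otimes$ is not associative: there exist decision spaces $X,Y,Z\in\mathbb{D}$ such that $(X\otimes Y)\otimes Z\neq X\otimes(Y\otimes Z)$.
   Context: Fix attributes $a_1,\dots,a_m$, each ranging over a bounded poset $D_{a_i}$. A decision space is a finite set of pairwise non-overlapping elements; an element $x$ is an $m$-dimensional polytope (subset of $D_{a_1}\times\cdots\times D_{a_m}$), called its space, together with a value $V(x)$, a class distribution vector with $c$ nonnegative components summing to $100\%$. $\mathbb{D}$ is the set of all decision spaces. For an element $x$: $A(x)$ is its set of attributes, $S(x,a)$ the one-dimensional space (interval or union of intervals) covered by $x$ along attribute $a$, and $|S(x,a)|$ its size. Strict subsumption: $x\prec y$ means $A(x)=A(y)$ and $S(x,a)\subsetneq S(y,a)$ for all $a\in A(x)$. For an element $x$ and decision space $Y$, the intersection $x\uplus Y$ is the set of all $y\in Y$ such that there exists $a\in A(x)\cap A(y)$ with $S(x,a)\cap S(y,a)\neq\emptyset$. Specialization: $M(x)=\frac{1}{|A(x)|}\sum_{a\in A(x)}|S(x,a)|$. Merged value: $V(x\otimes y)=V(x)\frac{M(x)}{M(x)+M(y)}+V(y)\frac{M(y)}{M(x)+M(y)}$. Merge operator $X\otimes Y$ (set operations on spaces are on point sets): Start with $Z=\emptyset$ and an empty map $H$ from elements of $Y$ to spaces. For each $x\in X$: if there is no $y\in Y$ with $x\prec y$ and $V(x)=V(y)$, then (i) if $x\uplus Y=\emptyset$, add $x$ to $Z$; (ii) otherwise let $tmp$ be the space of $x$; for each $y\in x\uplus Y$: create an element $z$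 with space $tmp\cap(\text{space of }y)$ and value $V(x\otimes y)$, add $z$ to $Z$; if $y$ is not yet a key of $H$ set $H(y)=(\text{space of }y)\setminus(\text{space of }z)$, else replace $H(y)$ by $H(y)\setminus(\text{space of }z)$; then replace the space of $x$ by (space of $x$)$\setminus$(space of $z$). Afterwards, if the remaining space of $x$ is nonempty, add $x$ (with that remaining space and value $V(x)$) to $Z$. Next, for each $y\in Y$ that is not a key of $H$: if there is no $x\in X$ with $y\prec x$ and $V(y)=V(x)$, add $y$ to $Z$. Finally, for each key $y$ of $H$ with $H(y)\neq\emptyset$, add the element with space $H(y)$ and value $V(y)$ to $Z$. The result is $X\otimes Y=Z$. -}

module Defs where

open import Data.Nat as ℕ using (ℕ; zero; suc)
open import Data.Fin as Fin using (Fin)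
open import Data.Vec as Vec using (Vec; []; _∷_)
import Data.Vec.Properties as VecP
open import Data.Bool using (Bool; true; false; _∧_; _∨_; not; if_then_else_)
open import Data.List as List using (List; []; _∷_; _∷ʳ_; allFin; length)
open import Data.Bool.ListAction using (any; all)
open import Data.Nat.ListAction using (sum)
open import Data.List.Relation.Unary.All using (All)
open import Data.List.Relation.Unary.Any using (Any)
open import Data.Maybe using (Maybe; just; nothing)
open import Data.Product using (Σ; _×_; _,_)
open import Data.Integer using (+_)
open import Data.Rational as ℚ using (ℚ; 0ℚ; _÷_)
open import Relation.Nullary using (¬_; yes; no)
open import Relation.Nullary.Decidable using (⌊_⌋)
open import Relation.Binary.PropositionalEquality using (_≡_; _≢_)
open import Function.Bundles using (_⇔_)

-- Setting: m attributes a₀,…,a_{m-1}, each ranging over the bounded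
-- chain Fin k (bottom = 0, top = k-1); class distributions over c classes.  Every element carries all m attributes,
-- so A(x) = {a₀,…,a_{m-1}} for every element.

module Setting (m : ℕ) .{{m≢0 : ℕ.NonZero m}} (k c : ℕ) where

  Attr : Set
  Attr = Fin m

  Dom : Set
  Dom = Fin k

  Point : Set
  Point = Vec Dom m

  allVecs : (n : ℕ) → List (Vec Dom n)
  allVecs zero    = [] ∷ []
  allVecs (suc n) = List.concatMap (λ d → List.map (d ∷_) (allVecs n)) (allFin k)

  allPoints : List Point
  allPoints = allVecs m

  Space : Set
  Space = Point → Bool

  _∩ˢ_ : Space → Space → Space
  (s ∩ˢ t) p = s p ∧ t p

  _∖ˢ_ : Space → Space → Space
  (s ∖ˢ t) p = s p ∧ not (t p)

  nonemptyᵇ : Space → Bool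
  nonemptyᵇ s = any s allPoints

  Value : Set
  Value = Vec ℚ c

  record Element : Set where
    constructor elem
    field
      space : Space
      value : Value
  open Element public

  DSpace : Set
  DSpace = List Element

  S : Element → Attr → Dom → Bool
  S x a d = any (λ p → space x p ∧ ⌊ Vec.lookup p a Fin.≟ d ⌋) allPoints

  size : Element → Attr → ℕ
  size x a = sum (List.map (λ d → if S x a d then 1 else 0) (allFin k))

  M : Element → ℚ
  M x = (+ sum (List.map (size x) (allFin m))) ℚ./ m

  ⊊ᵇ : (Dom → Bool) → (Dom → Bool) → Bool
  ⊊ᵇ s t = all (λ d → not (s d) ∨ t d) (allFin k)
         ∧ any (λ d → t d ∧ not (s d)) (allFin k)

  -- strict subsumption x ≺ y  (A(x) = A(y) holds trivially)
  _≺ᵇ_ : Element → Element → Bool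
  x ≺ᵇ y = all (λ a → ⊊ᵇ (S x a) (S y a)) (allFin m)

  _=ⱽ_ : Value → Value → Bool
  v =ⱽ w = ⌊ VecP.≡-dec ℚ._≟_ v w ⌋

  meetsᵇ : Element → Element → Bool
  meetsᵇ x y = any (λ a → any (λ d → S x a d ∧ S y a d) (allFin k)) (allFin m)

  _⊎ᴰ_ : Element → DSpace → DSpace
  x ⊎ᴰ Y = List.filterᵇ (meetsᵇ x) Y

  subsumedᵇ : Element → DSpace → Bool
  subsumedᵇ x Y = any (λ y → (x ≺ᵇ y) ∧ (value x =ⱽ value y)) Y

  -- V(x ⊗ y) = V(x) M(x)/(M(x)+M(y)) + V(y) M(y)/(M(x)+M(y))
  -- (the case M(x)+M(y) = 0 never arises in the merge operator, since
  --  y ∈ x ⊎ Y forces S(y,a) ≠ ∅ for some a; we then return V(x))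
  mergedValue : Element → Element → Value
  mergedValue x y with M x ℚ.+ M y ℚ.≟ 0ℚ
  ... | yes _ = value x
  ... | no ne =
    Vec.zipWith (λ vx vy → vx ℚ.* ((M x ÷ (M x ℚ.+ M y)) {{ℚ.≢-nonZero ne}})
                          ℚ.+ vy ℚ.* ((M y ÷ (M x ℚ.+ M y)) {{ℚ.≢-nonZero ne}}))
                (value x) (value y)

  -- The merge operator X ⊗ Y.
  -- The map H is represented by a list aligned with Y:
  -- nothing = "y is not a key of H", just s = "H(y) = s".

  -- inner loop over y ∈ Y for a fixed x (with original element x0,
  -- fixed tmp = space of x0, and current remaining space cur of x).
  -- Returns (new elements z, updated H, remaining space of x).
  innerLoop : Element → Space → List Element → List (Maybe Space)
            → List Element × List (Maybe Space) × Space
  innerLoop x0 cur []       _        = [] , [] , cur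
  innerLoop x0 cur (y ∷ Y)  []       = [] , [] , cur  -- unreachable (H aligned with Y)
  innerLoop x0 cur (y ∷ Y)  (h ∷ H) with meetsᵇ x0 y
  ... | false with innerLoop x0 cur Y H
  ...   | zs , H' , cur' = zs , h ∷ H' , cur'
  innerLoop x0 cur (y ∷ Y) (h ∷ H) | true =
    let z    = elem (space x0 ∩ˢ space y) (mergedValue x0 y)
        hnew = just (oldH h ∖ˢ space z)
        cur₁ = cur ∖ˢ space z
    in  rest z hnew (innerLoop x0 cur₁ Y H)
    where
      oldH : Maybe Space → Space
      oldH nothing  = space y
      oldH (just s) = s
      rest : Element → Maybe Space → List Element × List (Maybe Space) × Space
           → List Element × List (Maybe Space) × Space
      rest z hnew (zs , H' , cur') = z ∷ zs , hnew ∷ H' , cur'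

  stepX : DSpace → Element → DSpace × List (Maybe Space) → DSpace × List (Maybe Space)
  stepX Y x (Z , H) with subsumedᵇ x Y
  ... | true  = Z , H
  ... | false with x ⊎ᴰ Y
  ...   | []    = Z ∷ʳ x , H
  ...   | _ ∷ _ with innerLoop x (space x) Y H
  ...     | zs , H' , cur =
              (if nonemptyᵇ cur then (Z List.++ zs) ∷ʳ elem cur (value x)
                                else  Z List.++ zs) , H'

  loopX : DSpace → DSpace → DSpace × List (Maybe Space) → DSpace × List (Maybe Space)
  loopX Y []      st = st
  loopX Y (x ∷ X) st = loopX Y X (stepX Y x st)

  addNonKeys : DSpace → DSpace → List (Maybe Space) → DSpace
  addNonKeys X []      _              = []
  addNonKeys X (y ∷ Y) []             = []
  addNonKeys X (y ∷ Y) (nothing ∷ H)  =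
    if subsumedᵇ y X then addNonKeys X Y H else y ∷ addNonKeys X Y H
  addNonKeys X (y ∷ Y) (just _ ∷ H)   = addNonKeys X Y H

  addKeys : DSpace → List (Maybe Space) → DSpace
  addKeys []      _              = []
  addKeys (y ∷ Y) []             = []
  addKeys (y ∷ Y) (nothing ∷ H)  = addKeys Y H
  addKeys (y ∷ Y) (just s ∷ H)   =
    if nonemptyᵇ s then elem s (value y) ∷ addKeys Y H else addKeys Y H

  _⊗_ : DSpace → DSpace → DSpace
  X ⊗ Y with loopX Y X ([] , List.map (λ _ → nothing) Y)
  ... | Z , H = Z List.++ addNonKeys X Y H List.++ addKeys Y H

  IsPolytope : Space → Set
  IsPolytope s =
    Σ Point λ lo → Σ Point λ hi →
      (∀ a → Vec.lookup lo a Fin.≤ Vec.lookup hi a) ×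
      (∀ p → (s p ≡ true) ⇔
             (∀ a → (Vec.lookup lo a Fin.≤ Vec.lookup p a) × (Vec.lookup p a Fin.≤ Vec.lookup hi a)))

  IsDistribution : Value → Set
  IsDistribution v = (∀ i → 0ℚ ℚ.≤ Vec.lookup v i) × (Vec.foldr _ ℚ._+_ 0ℚ v ≡ + 100 ℚ./ 1)

  IsElement : Element → Set
  IsElement x = IsPolytope (space x) × IsDistribution (value x)

  Disjoint : Space → Space → Set
  Disjoint s t = ∀ p → ¬ ((s p ≡ true) × (t p ≡ true))

  IsDecisionSpace : DSpace → Set
  IsDecisionSpace X =
    All IsElement X ×
    (∀ (i j : Fin (length X)) → i ≢ j →
       Disjoint (space (List.lookup X i)) (space (List.lookup X j)))

  _≈ᴱ_ : Element → Element → Set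
  x ≈ᴱ y = (∀ p → space x p ≡ space y p) × (value x ≡ value y)

  _≈ᴰ_ : DSpace → DSpace → Set
  X ≈ᴰ Y = All (λ x → Any (x ≈ᴱ_) Y) X × All (λ y → Any (y ≈ᴱ_) X) Y

module Submission where

-- Non-associativity is witnessed
-- by an explicit counterexample in one dimension (m = 1), on the chain
-- {0,1,2} (k = 3) and with a single class (c = 1), all values being 100%:
--
--     X = {[0,1]},   Y = {[0,0]},   Z = {[1,2]}.
--
-- Merging X with Y splits [0,1] into [0] and [1]; in (X ⊗ Y) ⊗ Z the piece
-- [1] is strictly subsumed by [1,2] with equal value and disappears, so
-- (X ⊗ Y) ⊗ Z = {[0], [1,2]}.  On the other hand Y ⊗ Z = {[0], [1,2]}, and
-- merging X into it cuts [1,2] into [1] and [2], so X ⊗ (Y ⊗ Z) = {[0],[1],[2]}.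
-- The element [1,2] of the left side therefore has no equal on the right.

open import Defs
open import Data.Nat using (ℕ; NonZero; z≤n; s≤s)
open import Data.Fin as Fin using (Fin; zero; suc)
open import Data.Fin.Properties using (_≤?_)
open import Data.Vec using ([]; _∷_; lookup)
open import Data.List using ([]; _∷_; allFin)
open import Data.Bool using (Bool; true; false; T; _∧_)
open import Data.Bool.ListAction using (all)
open import Data.Bool.Properties using (T-∧; T-≡)
open import Data.Product using (Σ; _×_; _,_)
open import Data.Integer using (+_; +≤+)
import Data.Rational as ℚ
open import Data.List.Relation.Unary.All as All using (All; []; _∷_; lookupAny)
open import Data.List.Relation.Unary.All.Properties using (all⁺; all⁻; All¬⇒¬Any)
open import Data.List.Relation.Unary.Any using (Any; here; there)
open import Data.List.Membership.Propositional.Properties using (∈-allFin)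
open import Relation.Nullary using (¬_; contradiction)
open import Relation.Nullary.Decidable using (⌊_⌋; toWitness; fromWitness)
open import Relation.Binary.PropositionalEquality using (_≡_; refl; trans; sym)
open import Function.Bundles using (_⇔_; mk⇔; Equivalence)

all-allFin : ∀ {n} (f : Fin n → Bool) → T (all f (allFin n)) ⇔ (∀ i → T (f i))
all-allFin f = mk⇔ (λ t i → All.lookup (all⁺ f _ t) (∈-allFin i))
                   (λ h → all⁻ f {allFin _} (All.tabulate (λ {i} _ → h i)))

module DecisionSpaceFacts (m : ℕ) .{{m≢0 : NonZero m}} (k c : ℕ) where
  open Setting m k c

  inBounds : Point → Point → Point → Attr → Bool
  inBounds lo hi p a = ⌊ lookup lo a ≤? lookup p a ⌋ ∧ ⌊ lookup p a ≤? lookup hi a ⌋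

  box : Point → Point → Space
  box lo hi p = all (inBounds lo hi p) (allFin m)

  box-sound : ∀ lo hi p → (box lo hi p ≡ true) ⇔
              (∀ a → (lookup lo a Fin.≤ lookup p a) × (lookup p a Fin.≤ lookup hi a))
  box-sound lo hi p = mk⇔
    (λ eq a → inBounds⇒ a (Equivalence.to (all-allFin (inBounds lo hi p))
                                           (Equivalence.from T-≡ eq) a))
    (λ bounds → Equivalence.to T-≡
       (Equivalence.from (all-allFin (inBounds lo hi p)) (λ a → ⇒inBounds a (bounds a))))
    where
    inBounds⇒ : ∀ a → T (inBounds lo hi p a) →
                (lookup lo a Fin.≤ lookup p a) × (lookup p a Fin.≤ lookup hi a)
    inBounds⇒ a t with Equivalence.to (T-∧ {⌊ lookup lo a ≤? lookup p a ⌋}) t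
    ... | lower , upper = toWitness lower , toWitness upper
    ⇒inBounds : ∀ a → (lookup lo a Fin.≤ lookup p a) × (lookup p a Fin.≤ lookup hi a) →
                T (inBounds lo hi p a)
    ⇒inBounds a (lower , upper) = Equivalence.from T-∧
      ( fromWitness {a? = lookup lo a ≤? lookup p a} lower
      , fromWitness {a? = lookup p a ≤? lookup hi a} upper)

  box-isPolytope : ∀ lo hi → (∀ a → lookup lo a Fin.≤ lookup hi a) → IsPolytope (box lo hi)
  box-isPolytope lo hi lo≤hi = lo , hi , lo≤hi , box-sound lo hi

  singleton-isDecisionSpace : ∀ x → IsElement x → IsDecisionSpace (x ∷ [])
  singleton-isDecisionSpace x x-elem = (x-elem ∷ []) , λ { zero zero i≢j → contradiction refl i≢j }

  ≉ᴱ-at : ∀ {x y} p → space x p ≡ true → space y p ≡ false → ¬ x ≈ᴱ y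
  ≉ᴱ-at p x∋p y∌p (same-space , _) with () ← trans (sym x∋p) (trans (same-space p) y∌p)

  ≉ᴰ-by-witness : ∀ {A B} → Any (λ x → All (λ y → ¬ x ≈ᴱ y) B) A → ¬ A ≈ᴰ B
  ≉ᴰ-by-witness witness (A⊆B , _) with lookupAny A⊆B witness
  ... | x≈some-y , x≉every-y = All¬⇒¬Any x≉every-y x≈some-y

module Counterexample where
  open Setting 1 3 1
  open DecisionSpaceFacts 1 3 1

  interval : Fin 3 → Fin 3 → Space
  interval i j = box (i ∷ []) (j ∷ [])

  certain : Value
  certain = (+ 100 ℚ./ 1) ∷ []

  certain-isDistribution : IsDistribution certain
  certain-isDistribution = (λ { zero → ℚ.*≤* (+≤+ z≤n) }) , refl

  [_,_] : Fin 3 → Fin 3 → DSpace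
  [ i , j ] = elem (interval i j) certain ∷ []

  interval-isDecisionSpace : ∀ {i j : Fin 3} → i Fin.≤ j → IsDecisionSpace [ i , j ]
  interval-isDecisionSpace {i} {j} i≤j = singleton-isDecisionSpace _
    (box-isPolytope (i ∷ []) (j ∷ []) (λ { zero → i≤j }) , certain-isDistribution)

  X Y Z : DSpace
  X = [ zero , suc zero ]
  Y = [ zero , zero ]
  Z = [ suc zero , suc (suc zero) ]

  -- (X ⊗ Y) ⊗ Z evaluates to {[0], [1,2]} and X ⊗ (Y ⊗ Z) to {[0], [1], [2]};
  -- the element [1,2] (the second one on the left) contains the point 1,
  -- missing from [0] and [2], and the point 2, missing from [1].  Both
  -- sides are closed terms, so each membership test holds by evaluation.
  not-associative : ¬ (((X ⊗ Y) ⊗ Z) ≈ᴰ (X ⊗ (Y ⊗ Z)))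
  not-associative = ≉ᴰ-by-witness
    (there (here (≉ᴱ-at one refl refl ∷ ≉ᴱ-at two refl refl ∷ ≉ᴱ-at one refl refl ∷ [])))
    where
    one two : Point
    one = suc zero ∷ []
    two = suc (suc zero) ∷ []

open Counterexample using (X; Y; Z; interval-isDecisionSpace; not-associative)

theorem5 : Σ ℕ λ m → Σ (NonZero m) λ nz → Σ ℕ λ k → Σ (NonZero k) λ _ → Σ ℕ λ c →
             let open Setting m {{nz}} k c in
             Σ DSpace λ X → Σ DSpace λ Y → Σ DSpace λ Z →
               IsDecisionSpace X × IsDecisionSpace Y × IsDecisionSpace Z ×
               ¬ (((X ⊗ Y) ⊗ Z) ≈ᴰ (X ⊗ (Y ⊗ Z)))
theorem5 = 1 , _ , 3 , _ , 1 , X , Y , Z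
         , interval-isDecisionSpace z≤n
         , interval-isDecisionSpace z≤n
         , interval-isDecisionSpace (s≤s z≤n)
         , not-associative
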